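{- Let $G$ be a finite simple undirected graph and $C_1,C_2\in\mathcal{C}_{\mathcal{R}}$ with $|C_1|=|C_2|$. Then $C_1\sim_{\mathtt{pi}}C_2$ if and only if there exists a set of cycles $\mathcal{X}\subseteq\mathcal{C}_{\mathcal{R}}$ with $C_1,C_2\notin\mathcal{X}$ such that (1) there exists an MCB $\mathcal{M}_2$ with $\mathcal{X}\cup\{C_2\}\subseteq\mathcal{M}_2$, and (2) $C_1=C_2\oplus\bigoplus_{C'\in\mathcal{X}}C'$, i.e., $\mathcal{E}_{\mathcal{M}_2}(C_1)=\mathcal{X}\cup\{C_2\}$.
   Context: Let $G=(V,E)$ be a finite simple undirected graph. A cycle is a set $C\subseteq E$ such that every vertex of $G$ has even degree in the subgraph with edge set $C$; $|C|$ denotes the number of edges. The cycles form a vector space over $GF(2)$ under symmetric difference $\oplus$. A minimum cycle basis (MCB) is a basis $\mathcal{M}$ of this space minimizing $\sum_{B\in\mathcal{M}}|B|$. The set of relevant cycles $\mathcal{C}_{\mathcal{R}}$ is the union of all MCBs. For a basis $\mathcal{B}$ and a cycle $C$, $\mathcal{E}_{\mathcal{B}}(C)$ denotes the unique subset of $\mathcal{B}$ whose $\oplus$-sum is $C$. For $C_1,C_2\in\mathcal{C}_{\mathcal{R}}$, $C_1\sim_{\mathtt{pi}}C_2$ means there exists an MCB $\mathcal{M}_2$ with $C_2\in\mathcal{M}_2$ such that $(\mathcal{M}_2\setminus\{C_2\})\cup\{C_1\}$ is also an MCB. -}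

module Defs where

open import Data.Nat using (ℕ; zero; suc; _+_; _≤_)
open import Data.Bool using (Bool; true; false; _xor_; _∧_; _∨_; if_then_else_)
open import Data.Fin using (Fin; _≟_)
open import Data.Fin.Subset using (Subset; ⊥; ∣_∣)
open import Data.Product using (_×_; _,_; proj₁; proj₂; ∃; Σ)
open import Data.Sum using (_⊎_)
open import Data.Vec using (Vec; []; _∷_; zipWith; lookup; _[_]≔_; allFin)
import Data.Vec as V
import Data.Vec.Membership.Propositional as VM
open import Data.List using (List)
import Data.List as L
import Data.Nat.ListAction as LA
open import Data.List.Relation.Unary.All using (All)
open import Data.List.Relation.Unary.Unique.Propositional using (Unique)
import Data.List.Membership.Propositional as LM
open import Relation.Binary.PropositionalEquality using (_≡_; _≢_)
open import Relation.Nullary using (¬_)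
open import Relation.Nullary.Decidable using (⌊_⌋)

record Graph : Set where
  field
    n m   : ℕ
    ends  : Fin m → Fin n × Fin n
    loopless : ∀ e → proj₁ (ends e) ≢ proj₂ (ends e)
    noParallel : ∀ e f →
      ((proj₁ (ends e) ≡ proj₁ (ends f)) × (proj₂ (ends e) ≡ proj₂ (ends f))) ⊎
      ((proj₁ (ends e) ≡ proj₂ (ends f)) × (proj₂ (ends e) ≡ proj₁ (ends f))) →
      e ≡ f

module _ (G : Graph) where
  open Graph G

  EdgeSet : Set
  EdgeSet = Subset m

  _⊕_ : EdgeSet → EdgeSet → EdgeSet
  _⊕_ = zipWith _xor_

  infixl 6 _⊕_

  incident : Fin n → Fin m → Bool
  incident v e = ⌊ v ≟ proj₁ (ends e) ⌋ ∨ ⌊ v ≟ proj₂ (ends e) ⌋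

  degree : EdgeSet → Fin n → ℕ
  degree C v = LA.sum (L.map (λ e → if lookup C e ∧ incident v e then 1 else 0)
                            (L.allFin m))

  Even : ℕ → Set
  Even k = ∃ λ j → k ≡ j + j

  IsCycle : EdgeSet → Set
  IsCycle C = ∀ v → Even (degree C v)

  ⊕-sum : List EdgeSet → EdgeSet
  ⊕-sum = L.foldr _⊕_ ⊥

  sumSel : ∀ {k} → Vec EdgeSet k → Subset k → EdgeSet
  sumSel [] [] = ⊥
  sumSel (C ∷ B) (true ∷ s) = C ⊕ sumSel B s
  sumSel (C ∷ B) (false ∷ s) = sumSel B s

  record IsBasis {k} (B : Vec EdgeSet k) : Set where
    field
      cycles      : ∀ i → IsCycle (lookup B i)
      independent : ∀ s → sumSel B s ≡ ⊥ → s ≡ ⊥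
      spanning    : ∀ C → IsCycle C → ∃ λ s → sumSel B s ≡ C

  weight : ∀ {k} → Vec EdgeSet k → ℕ
  weight B = V.sum (V.map ∣_∣ B)

  record IsMCB {k} (B : Vec EdgeSet k) : Set where
    field
      basis   : IsBasis B
      minimal : ∀ {k'} (B' : Vec EdgeSet k') → IsBasis B' → weight B ≤ weight B'

  Relevant : EdgeSet → Set
  Relevant C = ∃ λ k → Σ (Vec EdgeSet k) λ M → IsMCB M × C VM.∈ M

  _∼pi_ : EdgeSet → EdgeSet → Set
  C₁ ∼pi C₂ = ∃ λ k → Σ (Vec EdgeSet k) λ M₂ → Σ (Fin k) λ i →
    lookup M₂ i ≡ C₂ × IsMCB M₂ × IsMCB (M₂ [ i ]≔ C₁)

{-# OPTIONS --safe #-}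

-- Everything is linear algebra over GF(2). Write C₁ = Σ_{j ∈ t} M j in an MCB M
-- with M i = C₂. Replacing M i by C₁ yields a basis exactly when i ∈ t, and then
-- it is again an MCB because |C₁| = |C₂|. So C₁ ∼pi C₂ amounts to i ∈ t, and
-- X = {M j | j ∈ t, j ≠ i} is the required set; conversely such an X supplies
-- the coordinates t of C₁ with i ∈ t.

module Submission where

open import Defs
open import Data.Fin.Subset using (∣_∣)
open import Data.Product using (_×_; ∃; Σ)
open import Data.List using (List)
open import Data.List.Relation.Unary.All using (All)
open import Data.List.Relation.Unary.Unique.Propositional using (Unique)
open import Data.List.Membership.Propositional using (_∉_)
open import Data.Vec using (Vec)
open import Data.Vec.Membership.Propositional using (_∈_)
open import Relation.Binary.PropositionalEquality using (_≡_)
open import Function using (_⇔_)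

open import Level using (Level)
open import Data.Nat using (ℕ; _+_; _≤_)
open import Data.Bool using (Bool; true; false; not; _xor_)
open import Data.Bool.Properties
  using (xor-assoc; xor-comm; xor-identityˡ; xor-identityʳ; xor-same; ¬-not)
open import Data.Fin using (Fin; zero; suc; _≟_)
open import Data.Fin.Properties using (suc-injective)
open import Data.Fin.Subset using (Subset; ⊥; ⁅_⁆)
open import Data.Fin.Subset.Properties using (x∈⁅x⁆; x∈⁅y⁆⇒x≡y)
open import Data.Product using (_,_)
open import Data.List using ([]; _∷_)
import Data.List.Membership.Propositional as List
open import Data.List.Relation.Unary.Any using (here; there)
import Data.List.Relation.Unary.All as All
open import Data.List.Relation.Unary.All.Properties using (¬Any⇒All¬)
open import Data.List.Relation.Unary.AllPairs using ([]; _∷_)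
open import Data.Vec using ([]; _∷_; zipWith; lookup; _[_]≔_)
open import Data.Vec.Properties
  using ( zipWith-assoc; zipWith-comm; zipWith-identityˡ; zipWith-identityʳ
        ; lookup-zipWith; lookup-replicate; lookup∘update; lookup∘update′
        ; []=⇒lookup; lookup⇒[]=)
open import Data.Vec.Relation.Unary.Any using (index)
open import Data.Vec.Relation.Unary.Any.Properties using (lookup-index)
open import Data.Vec.Membership.Propositional.Properties using (∈-lookup)
open import Function using (_∘_; mk⇔)
open import Function.Definitions using (Injective)
open import Relation.Binary.PropositionalEquality
  using (refl; sym; trans; cong; cong₂; subst; subst₂; _≢_; module ≡-Reasoning)
open import Relation.Nullary using (yes; no)

open ≡-Reasoning

private
  variable
    a : Level
    A : Set a
    n k : ℕ
    i : Fin k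
    s t : Subset k

infixl 6 _△_
infixr 7 _·_

-- The _⊕_ G of Defs, for subsets of any size: it also adds coordinate vectors.
_△_ : Subset n → Subset n → Subset n
_△_ = zipWith _xor_

_·_ : Bool → Subset n → Subset n
true  · s = s
false · s = ⊥

△-assoc : (x y z : Subset n) → x △ y △ z ≡ x △ (y △ z)
△-assoc = zipWith-assoc xor-assoc

△-comm : (x y : Subset n) → x △ y ≡ y △ x
△-comm = zipWith-comm xor-comm

△-identityˡ : (x : Subset n) → ⊥ △ x ≡ x
△-identityˡ = zipWith-identityˡ xor-identityˡ

△-identityʳ : (x : Subset n) → x △ ⊥ ≡ x
△-identityʳ = zipWith-identityʳ xor-identityʳ

△-self : (x : Subset n) → x △ x ≡ ⊥
△-self []      = refl
△-self (b ∷ x) = cong₂ _∷_ (xor-same b) (△-self x)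

△-cancelˡ : (x y : Subset n) → x △ (x △ y) ≡ y
△-cancelˡ x y = begin
  x △ (x △ y) ≡⟨ △-assoc x x y ⟨
  x △ x △ y   ≡⟨ cong (_△ y) (△-self x) ⟩
  ⊥ △ y       ≡⟨ △-identityˡ y ⟩
  y           ∎

△-cancelʳ : (x y : Subset n) → x △ y △ y ≡ x
△-cancelʳ x y = begin
  x △ y △ y   ≡⟨ △-assoc x y y ⟩
  x △ (y △ y) ≡⟨ cong (x △_) (△-self y) ⟩
  x △ ⊥       ≡⟨ △-identityʳ x ⟩
  x           ∎

△-interchange : (w x y z : Subset n) → (w △ x) △ (y △ z) ≡ (w △ y) △ (x △ z)
△-interchange w x y z = begin
  (w △ x) △ (y △ z) ≡⟨ △-assoc w x (y △ z) ⟩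
  w △ (x △ (y △ z)) ≡⟨ cong (w △_) (△-assoc x y z) ⟨
  w △ (x △ y △ z)   ≡⟨ cong (λ v → w △ (v △ z)) (△-comm x y) ⟩
  w △ (y △ x △ z)   ≡⟨ cong (w △_) (△-assoc y x z) ⟩
  w △ (y △ (x △ z)) ≡⟨ △-assoc w y (x △ z) ⟨
  (w △ y) △ (x △ z) ∎

△≡⊥⇒≡ : (x y : Subset n) → x △ y ≡ ⊥ → x ≡ y
△≡⊥⇒≡ x y x△y≡⊥ = sym (begin
  y           ≡⟨ △-cancelˡ x y ⟨
  x △ (x △ y) ≡⟨ cong (x △_) x△y≡⊥ ⟩
  x △ ⊥       ≡⟨ △-identityʳ x ⟩
  x           ∎)

·-distribʳ-xor : (b c : Bool) (x : Subset n) → (b xor c) · x ≡ b · x △ c · x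
·-distribʳ-xor true  true  x = sym (△-self x)
·-distribʳ-xor true  false x = sym (△-identityʳ x)
·-distribʳ-xor false true  x = sym (△-identityˡ x)
·-distribʳ-xor false false x = sym (△-identityˡ ⊥)

lookup-△ : (x y : Subset n) (i : Fin n) → lookup (x △ y) i ≡ lookup x i xor lookup y i
lookup-△ x y i = lookup-zipWith _xor_ i x y

lookup-⊥ : (i : Fin n) → lookup ⊥ i ≡ false
lookup-⊥ i = lookup-replicate i false

lookup-⁅i⁆-i : (i : Fin n) → lookup ⁅ i ⁆ i ≡ true
lookup-⁅i⁆-i i = []=⇒lookup (x∈⁅x⁆ i)

lookup-⁅⁆≡true⇒≡ : (i j : Fin n) → lookup ⁅ j ⁆ i ≡ true → i ≡ j
lookup-⁅⁆≡true⇒≡ i j ⁅j⁆ᵢ≡true = x∈⁅y⁆⇒x≡y j (lookup⇒[]= i ⁅ j ⁆ ⁅j⁆ᵢ≡true)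

lookup-⁅⁆-≢ : {i j : Fin n} → i ≢ j → lookup ⁅ j ⁆ i ≡ false
lookup-⁅⁆-≢ {i = i} {j} i≢j = ¬-not (i≢j ∘ lookup-⁅⁆≡true⇒≡ i j)

⁅⁆-injective : {i j : Fin n} → ⁅ i ⁆ ≡ ⁅ j ⁆ → i ≡ j
⁅⁆-injective {i = i} {j} ⁅i⁆≡⁅j⁆ =
  lookup-⁅⁆≡true⇒≡ i j (trans (cong (λ v → lookup v i) (sym ⁅i⁆≡⁅j⁆)) (lookup-⁅i⁆-i i))

lookup-⁅i⁆△ : (i : Fin n) (t : Subset n) → lookup (⁅ i ⁆ △ t) i ≡ not (lookup t i)
lookup-⁅i⁆△ i t = trans (lookup-△ ⁅ i ⁆ t i) (cong (_xor lookup t i) (lookup-⁅i⁆-i i))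

true≢false : true ≢ false
true≢false ()

[]≔-preserves : (P : A → Set) (xs : Vec A k) (i : Fin k) {x : A} →
  (∀ j → P (lookup xs j)) → P x → ∀ j → P (lookup (xs [ i ]≔ x) j)
[]≔-preserves P xs i {x} Pxs Px j with j ≟ i
... | yes refl = subst P (sym (lookup∘update i xs x)) Px
... | no j≢i   = subst P (sym (lookup∘update′ j≢i xs x)) (Pxs j)

selection : Vec A k → Subset k → List A
selection []       []          = []
selection (x ∷ xs) (true  ∷ s) = x ∷ selection xs s
selection (x ∷ xs) (false ∷ s) = selection xs s

∈-selection⁻ : (xs : Vec A k) (s : Subset k) {y : A} → y List.∈ selection xs s →
  ∃ λ j → lookup s j ≡ true × y ≡ lookup xs j
∈-selection⁻ []       []         ()
∈-selection⁻ (x ∷ xs) (true ∷ s) (here y≡x) = zero , refl , y≡x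
∈-selection⁻ (x ∷ xs) (true ∷ s) (there y∈) with ∈-selection⁻ xs s y∈
... | j , sⱼ , y≡ = suc j , sⱼ , y≡
∈-selection⁻ (x ∷ xs) (false ∷ s) y∈ with ∈-selection⁻ xs s y∈
... | j , sⱼ , y≡ = suc j , sⱼ , y≡

∈-selection⇒∈ : (xs : Vec A k) (s : Subset k) {y : A} → y List.∈ selection xs s → y ∈ xs
∈-selection⇒∈ xs s y∈ with ∈-selection⁻ xs s y∈
... | j , _ , refl = ∈-lookup j xs

lookup∉selection : (xs : Vec A k) → Injective _≡_ _≡_ (lookup xs) →
  lookup s i ≡ false → lookup xs i ∉ selection xs s
lookup∉selection {s = s} {i} xs inj sᵢ≡false xsᵢ∈ with ∈-selection⁻ xs s xsᵢ∈
... | j , sⱼ≡true , xsᵢ≡xsⱼ with inj xsᵢ≡xsⱼ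
... | refl = true≢false (trans (sym sⱼ≡true) sᵢ≡false)

selection-unique : (xs : Vec A k) (s : Subset k) →
  Injective _≡_ _≡_ (lookup xs) → Unique (selection xs s)
selection-unique []       []          inj = []
selection-unique (x ∷ xs) (true ∷ s)  inj =
  ¬Any⇒All¬ _ (lookup∉selection {s = false ∷ s} {zero} (x ∷ xs) inj refl)
  ∷ selection-unique xs s (suc-injective ∘ inj)
selection-unique (x ∷ xs) (false ∷ s) inj = selection-unique xs s (suc-injective ∘ inj)

selection-[]≔ : (xs : Vec A k) (i : Fin k) (y : A) →
  lookup s i ≡ false → selection (xs [ i ]≔ y) s ≡ selection xs s
selection-[]≔ {s = false ∷ s} (x ∷ xs) zero    y refl = refl
selection-[]≔ {s = true  ∷ s} (x ∷ xs) (suc i) y sᵢ   = cong (x ∷_) (selection-[]≔ xs i y sᵢ)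
selection-[]≔ {s = false ∷ s} (x ∷ xs) (suc i) y sᵢ   = selection-[]≔ xs i y sᵢ

module _ (G : Graph) where

  Independent : Vec (EdgeSet G) k → Set
  Independent B = ∀ s → sumSel G B s ≡ ⊥ → s ≡ ⊥

  sumSel-∷ : (C : EdgeSet G) (B : Vec (EdgeSet G) k) (b : Bool) (s : Subset k) →
    sumSel G (C ∷ B) (b ∷ s) ≡ b · C △ sumSel G B s
  sumSel-∷ C B true  s = refl
  sumSel-∷ C B false s = sym (△-identityˡ _)

  sumSel-⊥ : (B : Vec (EdgeSet G) k) → sumSel G B ⊥ ≡ ⊥
  sumSel-⊥ []      = refl
  sumSel-⊥ (C ∷ B) = sumSel-⊥ B

  sumSel-△ : (B : Vec (EdgeSet G) k) (s t : Subset k) →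
    sumSel G B (s △ t) ≡ sumSel G B s △ sumSel G B t
  sumSel-△ []      []      []      = sym (△-self ⊥)
  sumSel-△ (C ∷ B) (b ∷ s) (c ∷ t) = begin
    sumSel G (C ∷ B) ((b xor c) ∷ (s △ t))
      ≡⟨ sumSel-∷ C B (b xor c) (s △ t) ⟩
    (b xor c) · C △ sumSel G B (s △ t)
      ≡⟨ cong₂ _△_ (·-distribʳ-xor b c C) (sumSel-△ B s t) ⟩
    (b · C △ c · C) △ (sumSel G B s △ sumSel G B t)
      ≡⟨ △-interchange (b · C) (c · C) _ _ ⟩
    (b · C △ sumSel G B s) △ (c · C △ sumSel G B t)
      ≡⟨ cong₂ _△_ (sumSel-∷ C B b s) (sumSel-∷ C B c t) ⟨
    sumSel G (C ∷ B) (b ∷ s) △ sumSel G (C ∷ B) (c ∷ t)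
      ∎

  sumSel-· : (B : Vec (EdgeSet G) k) (b : Bool) (s : Subset k) →
    sumSel G B (b · s) ≡ b · sumSel G B s
  sumSel-· B true  s = refl
  sumSel-· B false s = sumSel-⊥ B

  sumSel-⁅⁆ : (B : Vec (EdgeSet G) k) (i : Fin k) → sumSel G B ⁅ i ⁆ ≡ lookup B i
  sumSel-⁅⁆ (C ∷ B) zero    = trans (cong (C △_) (sumSel-⊥ B)) (△-identityʳ C)
  sumSel-⁅⁆ (C ∷ B) (suc i) = sumSel-⁅⁆ B i

  sumSel-[]≔ : (B : Vec (EdgeSet G) k) (i : Fin k) (C : EdgeSet G) (s : Subset k) →
    sumSel G (B [ i ]≔ C) s ≡ sumSel G B s △ lookup s i · (lookup B i △ C)
  sumSel-[]≔ (D ∷ B) zero C (true ∷ s) = begin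
    C △ sumSel G B s               ≡⟨ △-comm C _ ⟩
    sumSel G B s △ C               ≡⟨ △-identityˡ _ ⟨
    ⊥ △ (sumSel G B s △ C)         ≡⟨ cong (_△ (sumSel G B s △ C)) (△-self D) ⟨
    (D △ D) △ (sumSel G B s △ C)   ≡⟨ △-interchange D D _ C ⟩
    (D △ sumSel G B s) △ (D △ C)   ∎
  sumSel-[]≔ (D ∷ B) zero    C (false ∷ s) = sym (△-identityʳ _)
  sumSel-[]≔ (D ∷ B) (suc i) C (true  ∷ s) =
    trans (cong (D △_) (sumSel-[]≔ B i C s)) (sym (△-assoc D _ _))
  sumSel-[]≔ (D ∷ B) (suc i) C (false ∷ s) = sumSel-[]≔ B i C s

  sumSel-injective : (B : Vec (EdgeSet G) k) → Independent B →
    sumSel G B s ≡ sumSel G B t → s ≡ t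
  sumSel-injective {s = s} {t} B indep Σs≡Σt = △≡⊥⇒≡ s t (indep (s △ t) (begin
    sumSel G B (s △ t)              ≡⟨ sumSel-△ B s t ⟩
    sumSel G B s △ sumSel G B t     ≡⟨ cong (_△ sumSel G B t) Σs≡Σt ⟩
    sumSel G B t △ sumSel G B t     ≡⟨ △-self _ ⟩
    ⊥                               ∎))

  independent⇒lookup-injective : (B : Vec (EdgeSet G) k) → Independent B →
    Injective _≡_ _≡_ (lookup B)
  independent⇒lookup-injective B indep {i} {j} Bᵢ≡Bⱼ =
    ⁅⁆-injective (sumSel-injective B indep (begin
      sumSel G B ⁅ i ⁆ ≡⟨ sumSel-⁅⁆ B i ⟩
      lookup B i       ≡⟨ Bᵢ≡Bⱼ ⟩
      lookup B j       ≡⟨ sumSel-⁅⁆ B j ⟨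
      sumSel G B ⁅ j ⁆ ∎))

  ⊕-sum-selection : (B : Vec (EdgeSet G) k) (s : Subset k) →
    ⊕-sum G (selection B s) ≡ sumSel G B s
  ⊕-sum-selection []      []          = refl
  ⊕-sum-selection (C ∷ B) (true  ∷ s) = cong (C △_) (⊕-sum-selection B s)
  ⊕-sum-selection (C ∷ B) (false ∷ s) = ⊕-sum-selection B s

  ⊕-sum-coordinates : (B : Vec (EdgeSet G) k) (Y : List (EdgeSet G)) → All (_∈ B) Y →
    ∃ λ u → sumSel G B u ≡ ⊕-sum G Y × (∀ j → lookup B j ∉ Y → lookup u j ≡ false)
  ⊕-sum-coordinates B [] All.[] = ⊥ , sumSel-⊥ B , λ j _ → lookup-⊥ j
  ⊕-sum-coordinates B (C ∷ Y) (C∈B All.∷ Y⊆B) with ⊕-sum-coordinates B Y Y⊆B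
  ... | u , Σu≡ΣY , u-support = ⁅ c ⁆ △ u , sum , support
    where
    c = index C∈B

    C≡Bc : C ≡ lookup B c
    C≡Bc = lookup-index C∈B

    sum : sumSel G B (⁅ c ⁆ △ u) ≡ C △ ⊕-sum G Y
    sum = trans (sumSel-△ B ⁅ c ⁆ u) (cong₂ _△_ (trans (sumSel-⁅⁆ B c) (sym C≡Bc)) Σu≡ΣY)

    support : ∀ j → lookup B j ∉ C ∷ Y → lookup (⁅ c ⁆ △ u) j ≡ false
    support j Bⱼ∉ = trans (lookup-△ ⁅ c ⁆ u j)
      (cong₂ _xor_ (lookup-⁅⁆-≢ j≢c) (u-support j (Bⱼ∉ ∘ there)))
      where
      j≢c : j ≢ c
      j≢c refl = Bⱼ∉ (here (sym C≡Bc))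

  relevant⇒cycle : {C : EdgeSet G} → Relevant G C → IsCycle G C
  relevant⇒cycle (_ , M , M-mcb , C∈M) =
    subst (IsCycle G) (sym (lookup-index C∈M))
      (IsBasis.cycles (IsMCB.basis M-mcb) (index C∈M))

  weight-[]≔ : (B : Vec (EdgeSet G) k) (i : Fin k) {C : EdgeSet G} →
    ∣ C ∣ ≡ ∣ lookup B i ∣ → weight G (B [ i ]≔ C) ≡ weight G B
  weight-[]≔ (D ∷ B) zero    |C|≡ = cong (_+ _) |C|≡
  weight-[]≔ (D ∷ B) (suc i) |C|≡ = cong (∣ D ∣ +_) (weight-[]≔ B i |C|≡)

  exchange-isMCB : {M : Vec (EdgeSet G) k} {C : EdgeSet G} → IsMCB G M →
    ∣ C ∣ ≡ ∣ lookup M i ∣ → IsBasis G (M [ i ]≔ C) → IsMCB G (M [ i ]≔ C)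
  exchange-isMCB {i = i} {M} M-mcb |C|≡ basis = record
    { basis   = basis
    ; minimal = λ B B-basis →
        subst (_≤ weight G B) (sym (weight-[]≔ M i |C|≡)) (IsMCB.minimal M-mcb B B-basis)
    }

  exchange-coefficient : (M : Vec (EdgeSet G) k) (i : Fin k) {C : EdgeSet G} →
    Independent (M [ i ]≔ C) → sumSel G M t ≡ C → lookup t i ≡ true
  exchange-coefficient {t = t} M i {C} indep Σt≡C = ¬-not λ tᵢ≡false →
    true≢false (begin
      true           ≡⟨ lookup-⁅i⁆-i i ⟨
      lookup ⁅ i ⁆ i ≡⟨ cong (λ v → lookup v i) (t≡⁅i⁆ tᵢ≡false) ⟨
      lookup t i     ≡⟨ tᵢ≡false ⟩
      false          ∎)
    where
    t≡⁅i⁆ : lookup t i ≡ false → t ≡ ⁅ i ⁆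
    t≡⁅i⁆ tᵢ≡false = sumSel-injective (M [ i ]≔ C) indep (begin
      sumSel G (M [ i ]≔ C) t                  ≡⟨ sumSel-[]≔ M i C t ⟩
      sumSel G M t △ lookup t i · (lookup M i △ C)
        ≡⟨ cong (λ b → sumSel G M t △ b · (lookup M i △ C)) tᵢ≡false ⟩
      sumSel G M t △ ⊥                         ≡⟨ △-identityʳ _ ⟩
      sumSel G M t                             ≡⟨ Σt≡C ⟩
      C                                        ≡⟨ lookup∘update i M C ⟨
      lookup (M [ i ]≔ C) i                    ≡⟨ sumSel-⁅⁆ (M [ i ]≔ C) i ⟨
      sumSel G (M [ i ]≔ C) ⁅ i ⁆              ∎)

  module Rebase (M : Vec (EdgeSet G) k) (i : Fin k) (C : EdgeSet G) (t : Subset k)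
                (Σt≡C : sumSel G M t ≡ C) where

    -- Substituting C = Σ_{j ∈ t} M j for the i-th vector turns coordinates with respect to
    -- M [ i ]≔ C into coordinates with respect to M.
    rebase : Subset k → Subset k
    rebase s = s △ lookup s i · (⁅ i ⁆ △ t)

    sumSel-rebase : ∀ s → sumSel G (M [ i ]≔ C) s ≡ sumSel G M (rebase s)
    sumSel-rebase s = begin
      sumSel G (M [ i ]≔ C) s
        ≡⟨ sumSel-[]≔ M i C s ⟩
      sumSel G M s △ sᵢ · (lookup M i △ C)
        ≡⟨ cong (λ v → sumSel G M s △ sᵢ · v) Mᵢ△C ⟩
      sumSel G M s △ sᵢ · sumSel G M (⁅ i ⁆ △ t)
        ≡⟨ cong (sumSel G M s △_) (sumSel-· M sᵢ _) ⟨
      sumSel G M s △ sumSel G M (sᵢ · (⁅ i ⁆ △ t))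
        ≡⟨ sumSel-△ M s _ ⟨
      sumSel G M (rebase s)
        ∎
      where
      sᵢ = lookup s i

      Mᵢ△C : lookup M i △ C ≡ sumSel G M (⁅ i ⁆ △ t)
      Mᵢ△C = sym (trans (sumSel-△ M ⁅ i ⁆ t) (cong₂ _△_ (sumSel-⁅⁆ M i) Σt≡C))

    rebase-⊥ : rebase ⊥ ≡ ⊥
    rebase-⊥ = begin
      ⊥ △ lookup ⊥ i · (⁅ i ⁆ △ t)  ≡⟨ cong (λ b → ⊥ △ b · (⁅ i ⁆ △ t)) (lookup-⊥ i) ⟩
      ⊥ △ ⊥                         ≡⟨ △-self ⊥ ⟩
      ⊥                             ∎

    module _ (tᵢ≡true : lookup t i ≡ true) where

      lookup-rebase : ∀ s → lookup (rebase s) i ≡ lookup s i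
      lookup-rebase s = begin
        lookup (rebase s) i                         ≡⟨ lookup-△ s _ i ⟩
        lookup s i xor lookup (sᵢ · (⁅ i ⁆ △ t)) i  ≡⟨ cong (sᵢ xor_) (·-vanishes sᵢ) ⟩
        lookup s i xor false                        ≡⟨ xor-identityʳ sᵢ ⟩
        lookup s i                                  ∎
        where
        sᵢ = lookup s i

        ·-vanishes : ∀ b → lookup (b · (⁅ i ⁆ △ t)) i ≡ false
        ·-vanishes true  = trans (lookup-⁅i⁆△ i t) (cong not tᵢ≡true)
        ·-vanishes false = lookup-⊥ i

      rebase-involutive : ∀ s → rebase (rebase s) ≡ s
      rebase-involutive s = begin
        rebase s △ lookup (rebase s) i · (⁅ i ⁆ △ t)
          ≡⟨ cong (λ b → rebase s △ b · (⁅ i ⁆ △ t)) (lookup-rebase s) ⟩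
        rebase s △ lookup s i · (⁅ i ⁆ △ t)
          ≡⟨ △-cancelʳ s _ ⟩
        s
          ∎

  exchange-isBasis : {M : Vec (EdgeSet G) k} {C : EdgeSet G} → IsBasis G M → IsCycle G C →
    sumSel G M t ≡ C → lookup t i ≡ true → IsBasis G (M [ i ]≔ C)
  exchange-isBasis {t = t} {i} {M} {C} M-basis C-cycle Σt≡C tᵢ≡true = record
    { cycles      = []≔-preserves (IsCycle G) M i (IsBasis.cycles M-basis) C-cycle
    ; independent = λ s Σs≡⊥ → begin
        s                   ≡⟨ rebase-involutive tᵢ≡true s ⟨
        rebase (rebase s)   ≡⟨ cong rebase (IsBasis.independent M-basis (rebase s)
                                 (trans (sym (sumSel-rebase s)) Σs≡⊥)) ⟩
        rebase ⊥            ≡⟨ rebase-⊥ ⟩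
        ⊥                   ∎
    ; spanning    = λ D D-cycle →
        let (u , Σu≡D) = IsBasis.spanning M-basis D D-cycle in
        rebase u , (begin
          sumSel G (M [ i ]≔ C) (rebase u) ≡⟨ sumSel-rebase (rebase u) ⟩
          sumSel G M (rebase (rebase u))   ≡⟨ cong (sumSel G M) (rebase-involutive tᵢ≡true u) ⟩
          sumSel G M u                     ≡⟨ Σu≡D ⟩
          D                                ∎)
    }
    where open Rebase M i C t Σt≡C

  PiWitness : EdgeSet G → EdgeSet G → Set
  PiWitness C₁ C₂ = Σ (List (EdgeSet G)) λ X →
    Unique X × All (Relevant G) X × C₁ ∉ X × C₂ ∉ X ×
    (∃ λ k → Σ (Vec (EdgeSet G) k) λ M₂ →
      IsMCB G M₂ × All (λ C → C ∈ M₂) X × C₂ ∈ M₂) ×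
    C₁ ≡ _⊕_ G C₂ (⊕-sum G X)

  expansion-witness : {M : Vec (EdgeSet G) k} {C₁ : EdgeSet G} →
    IsMCB G M → Independent (M [ i ]≔ C₁) → sumSel G M t ≡ C₁ → lookup t i ≡ true →
    PiWitness C₁ (lookup M i)
  expansion-witness {i = i} {t} {M} {C₁} M-mcb M′-indep Σt≡C₁ tᵢ≡true =
    X , selection-unique M t∖i M-injective , All.tabulate X⊆relevant ,
    C₁∉X , lookup∉selection M M-injective t∖iᵢ≡false ,
    (_ , M , M-mcb , All.tabulate (∈-selection⇒∈ M t∖i) , ∈-lookup i M) , C₁≡Mᵢ△ΣX
    where
    t∖i = ⁅ i ⁆ △ t
    X = selection M t∖i

    M-injective : Injective _≡_ _≡_ (lookup M)
    M-injective = independent⇒lookup-injective M (IsBasis.independent (IsMCB.basis M-mcb))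

    t∖iᵢ≡false : lookup t∖i i ≡ false
    t∖iᵢ≡false = trans (lookup-⁅i⁆△ i t) (cong not tᵢ≡true)

    X⊆relevant : ∀ {C} → C List.∈ X → Relevant G C
    X⊆relevant C∈X = _ , M , M-mcb , ∈-selection⇒∈ M t∖i C∈X

    C₁∉X : C₁ ∉ X
    C₁∉X = subst₂ _∉_ (lookup∘update i M C₁) (selection-[]≔ M i C₁ t∖iᵢ≡false)
      (lookup∉selection (M [ i ]≔ C₁)
        (independent⇒lookup-injective (M [ i ]≔ C₁) M′-indep) t∖iᵢ≡false)

    C₁≡Mᵢ△ΣX : C₁ ≡ lookup M i △ ⊕-sum G X
    C₁≡Mᵢ△ΣX = sym (begin
      lookup M i △ ⊕-sum G X
        ≡⟨ cong (lookup M i △_) (⊕-sum-selection M t∖i) ⟩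
      lookup M i △ sumSel G M (⁅ i ⁆ △ t)
        ≡⟨ cong (lookup M i △_) (sumSel-△ M ⁅ i ⁆ t) ⟩
      lookup M i △ (sumSel G M ⁅ i ⁆ △ sumSel G M t)
        ≡⟨ cong₂ (λ x y → lookup M i △ (x △ y)) (sumSel-⁅⁆ M i) Σt≡C₁ ⟩
      lookup M i △ (lookup M i △ C₁)
        ≡⟨ △-cancelˡ _ C₁ ⟩
      C₁
        ∎)

  ∼pi⇒witness : {C₁ C₂ : EdgeSet G} → IsCycle G C₁ → _∼pi_ G C₁ C₂ → PiWitness C₁ C₂
  ∼pi⇒witness {C₁} C₁-cycle (_ , M , i , refl , M-mcb , M′-mcb)
    with IsBasis.spanning (IsMCB.basis M-mcb) C₁ C₁-cycle
  ... | t , Σt≡C₁ =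
    expansion-witness M-mcb M′-indep Σt≡C₁ (exchange-coefficient M i M′-indep Σt≡C₁)
    where
    M′-indep = IsBasis.independent (IsMCB.basis M′-mcb)

  witness⇒∼pi : {C₁ C₂ : EdgeSet G} → IsCycle G C₁ → ∣ C₁ ∣ ≡ ∣ C₂ ∣ →
    PiWitness C₁ C₂ → _∼pi_ G C₁ C₂
  witness⇒∼pi {C₁} {C₂} C₁-cycle |C₁|≡|C₂|
    (X , _ , _ , _ , C₂∉X , (k , M , M-mcb , X⊆M , C₂∈M) , C₁≡C₂△ΣX)
    with ⊕-sum-coordinates M X X⊆M
  ... | u , Σu≡ΣX , u-support =
    k , M , i₂ , sym C₂≡Mᵢ₂ , M-mcb ,
    exchange-isMCB M-mcb (trans |C₁|≡|C₂| (cong ∣_∣ C₂≡Mᵢ₂))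
      (exchange-isBasis (IsMCB.basis M-mcb) C₁-cycle Σt₁≡C₁ i₂∈t₁)
    where
    i₂ = index C₂∈M

    C₂≡Mᵢ₂ : C₂ ≡ lookup M i₂
    C₂≡Mᵢ₂ = lookup-index C₂∈M

    t₁ = ⁅ i₂ ⁆ △ u

    Σt₁≡C₁ : sumSel G M t₁ ≡ C₁
    Σt₁≡C₁ = begin
      sumSel G M (⁅ i₂ ⁆ △ u)            ≡⟨ sumSel-△ M ⁅ i₂ ⁆ u ⟩
      sumSel G M ⁅ i₂ ⁆ △ sumSel G M u   ≡⟨ cong₂ _△_ (sumSel-⁅⁆ M i₂) Σu≡ΣX ⟩
      lookup M i₂ △ ⊕-sum G X            ≡⟨ cong (_△ ⊕-sum G X) C₂≡Mᵢ₂ ⟨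
      C₂ △ ⊕-sum G X                    ≡⟨ C₁≡C₂△ΣX ⟨
      C₁                                ∎

    i₂∈t₁ : lookup t₁ i₂ ≡ true
    i₂∈t₁ = trans (lookup-⁅i⁆△ i₂ u)
      (cong not (u-support i₂ (subst (_∉ X) C₂≡Mᵢ₂ C₂∉X)))

lemma5 : (G : Graph) (C₁ C₂ : EdgeSet G) →
    Relevant G C₁ → Relevant G C₂ → ∣ C₁ ∣ ≡ ∣ C₂ ∣ →
    (_∼pi_ G C₁ C₂ ⇔
      (Σ (List (EdgeSet G)) λ X →
        Unique X × All (Relevant G) X × C₁ ∉ X × C₂ ∉ X ×
        (∃ λ k → Σ (Vec (EdgeSet G) k) λ M₂ →
          IsMCB G M₂ × All (λ C → C ∈ M₂) X × C₂ ∈ M₂) ×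
        C₁ ≡ _⊕_ G C₂ (⊕-sum G X)))
lemma5 G C₁ C₂ C₁-relevant _ |C₁|≡|C₂| =
  mk⇔ (∼pi⇒witness G C₁-cycle) (witness⇒∼pi G C₁-cycle |C₁|≡|C₂|)
  where
  C₁-cycle : IsCycle G C₁
  C₁-cycle = relevant⇒cycle G C₁-relevant
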